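{- Fix an integer $k\ge 2$ and let $T$ be a $k$-donation tree with $n$ leaves (the donors) and depth $O(\log_k n)$, with root $R$ and total donation $M=D(R)$. Assume that every donation lies in the range $[1,a]$, and that each donor independently participates in the verification with probability at least $\delta$. Then each donor's verification takes $O(\log_k n)$ steps. Moreover, for $0<\epsilon<1$, if the published report is not a $(1-\epsilon)$-approximation, i.e. $V(R)<(1-\epsilon)M$, then an error is reported with probability at least $1-(1-\delta)^{\lceil \epsilon M/a\rceil}$.
   Context: A donation tree is a rooted tree whose leaves correspond to donors. Each leaf $L$ carries a donation value $D(L)$, the amount given by that donor; for an internal node $N$, $D(N)$ is the sum of $D(\cdot)$ over the leaves of the subtree rooted at $N$. The collector publishes the tree together with a value $V(N)$ at every node $N$, the amount the collector claims to have received from the leaves of the subtree rooted at $N$. A $k$-donation tree is one in which every internal node has at most $k$ children. Verification by the donor at leaf $m$: check that $V(m)=D(m)$, and for every internal node $N$ on the path from $m$ to the root, with children $N_1,\dots,N_r$, check that $V(N)=V(N_1)+\cdots+V(N_r)$; an error is reported if any participating donor's check fails. -}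

module Defs where

open import Data.Bool using (Bool; true; false; _∧_; not; if_then_else_)
open import Data.Nat as ℕ using (ℕ; zero; suc; _⊔_; _∸_; NonZero)
open import Data.Nat.DivMod using (_/_)
open import Data.Fin using (Fin)
import Data.Fin as Fin
open import Data.List using (List; []; _∷_; length; map; concat; lookup; allFin)
open import Data.Bool.ListAction using (or)
open import Data.List.Relation.Unary.All using (All)
open import Data.Vec.Functional using () renaming (_∷_ to _∷ᶠ_)
open import Data.Rational as ℚ using (ℚ; 0ℚ; 1ℚ; _+_; _*_; _-_)
open import Data.Rational.Properties using (_≟_)
open import Relation.Nullary.Decidable using (⌊_⌋)

-- Donation trees.
-- A leaf (a donor) carries its donation D and the published value V;
-- an internal node carries its published value V and its list of children.

data Tree : Set where
  leaf : (d v : ℚ) → Tree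
  node : (v : ℚ) → (children : List Tree) → Tree

V : Tree → ℚ
V (leaf d v) = v
V (node v ts) = v

mutual
  D : Tree → ℚ
  D (leaf d v) = d
  D (node v ts) = Ds ts

  Ds : List Tree → ℚ
  Ds [] = 0ℚ
  Ds (t ∷ ts) = D t + Ds ts

sumV : List Tree → ℚ
sumV [] = 0ℚ
sumV (t ∷ ts) = V t + sumV ts

mutual
  nLeaves : Tree → ℕ
  nLeaves (leaf d v) = 1
  nLeaves (node v ts) = nLeavesL ts

  nLeavesL : List Tree → ℕ
  nLeavesL [] = 0
  nLeavesL (t ∷ ts) = nLeaves t ℕ.+ nLeavesL ts

mutual
  depth : Tree → ℕ
  depth (leaf d v) = 0
  depth (node v ts) = suc (depthL ts)

  depthL : List Tree → ℕ
  depthL [] = 0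
  depthL (t ∷ ts) = depth t ⊔ depthL ts

mutual
  -- Every internal node has at least one and at most k children,
  -- and all values V are nonnegative (they are amounts of money received).
  data IsKTree (k : ℕ) : Tree → Set where
    leafK : ∀ {d v} → 0ℚ ℚ.≤ v → IsKTree k (leaf d v)
    nodeK : ∀ {v ts} → 0ℚ ℚ.≤ v → 1 ℕ.≤ length ts → length ts ℕ.≤ k →
            IsKTreeL k ts → IsKTree k (node v ts)

  data IsKTreeL (k : ℕ) : List Tree → Set where
    []  : IsKTreeL k []
    _∷_ : ∀ {t ts} → IsKTree k t → IsKTreeL k ts → IsKTreeL k (t ∷ ts)

mutual
  donations : Tree → List ℚ
  donations (leaf d v) = d ∷ []
  donations (node v ts) = donationsL ts

  donationsL : List Tree → List ℚ
  donationsL [] = []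
  donationsL (t ∷ ts) = donations t Data.List.++ donationsL ts

mutual
  -- For each leaf m (left to right): does the verification of donor m pass?
  -- It checks V(m) = D(m) and V(N) = V(N₁)+⋯+V(N_r) at every internal
  -- node N on the path from m to the root.
  passes : Tree → List Bool
  passes (leaf d v) = ⌊ v ≟ d ⌋ ∷ []
  passes (node v ts) = map (λ b → b ∧ ⌊ v ≟ sumV ts ⌋) (passesL ts)

  passesL : List Tree → List Bool
  passesL [] = []
  passesL (t ∷ ts) = passes t Data.List.++ passesL ts

mutual
  -- For each leaf m: number of elementary steps of donor m's verification:
  -- one comparison at the leaf, and at each internal node on the path with
  -- r children, r steps (r-1 additions and one comparison).
  steps : Tree → List ℕ
  steps (leaf d v) = 1 ∷ []
  steps (node v ts) = map (λ s → s ℕ.+ length ts) (stepsL ts)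

  stepsL : List Tree → List ℕ
  stepsL [] = []
  stepsL (t ∷ ts) = steps t Data.List.++ stepsL ts

-- ⌊log_k n⌋ (with ⌊log_k 0⌋ = 0), computed with fuel n.

logK : (k : ℕ) → .{{_ : NonZero k}} → ℕ → ℕ
logK k n = go n n
  where
  go : ℕ → ℕ → ℕ
  go zero m = 0
  go (suc fuel) m with m ℕ.<ᵇ k
  ... | true = 0
  ... | false = suc (go fuel (m / k))

_^ℚ_ : ℚ → ℕ → ℚ
q ^ℚ zero = 1ℚ
q ^ℚ suc n = q * (q ^ℚ n)

-- Probability of an event E ⊆ {participating sets} when donor i
-- participates independently with probability p i (product measure on
-- {true,false}^n).

Pr : (n : ℕ) → (p : Fin n → ℚ) → ((Fin n → Bool) → Bool) → ℚ
Pr zero p E = if E (λ ()) then 1ℚ else 0ℚ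
Pr (suc n) p E =
  p Fin.zero * Pr n (λ i → p (Fin.suc i)) (λ s → E (true ∷ᶠ s)) +
  (1ℚ - p Fin.zero) * Pr n (λ i → p (Fin.suc i)) (λ s → E (false ∷ᶠ s))

errorReported : (T : Tree) → (Fin (length (passes T)) → Bool) → Bool
errorReported T s =
  or (map (λ i → s i ∧ not (lookup (passes T) i)) (allFin (length (passes T))))

-- Each donor's check climbs the tree once, doing at most k steps per level,
-- so it costs at most 1 + k · depth = O(log_k n) steps.
--
-- For detection, call a leaf failing when its donor's check would fail.
-- If the check at a node fails, all leaves below it fail; if it succeeds,
-- V(N) is the sum of the children's values.  Hence, by induction,
-- D(N) ≤ V(N) + (total donation of the failing leaves below N), using
-- V ≥ 0 at the failing nodes.  An under-report V(R) < (1 − ε)M therefore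
-- forces the failing leaves to carry more than εM, and, since each gives at
-- most a, there are at least ⌈εM/a⌉ of them.  An error is missed only if
-- none of them participates, which has probability at most (1 − δ)^⌈εM/a⌉.
module Submission where

open import Level using (0ℓ)
open import Algebra.Bundles using (CommutativeMonoid)
open import Data.Bool using (Bool; true; false; _∧_; not; if_then_else_)
open import Data.Bool.ListAction using (or)
open import Data.Nat as ℕ using (ℕ; zero; suc; _≤_; _<_; z≤n; s≤s; NonZero)
import Data.Nat.Properties as ℕ
open import Data.Nat.DivMod using (_%_; m/n*n≤m)
import Data.Nat.Tactic.RingSolver as ℕ-Solver
open import Data.Integer as ℤ using (-[1+_]; +[1+_]; ∣_∣)
import Data.Integer.Properties as ℤ
open import Data.Integer.DivMod using (_/ℕ_; div-pos-is-/ℕ)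
import Data.Integer.Tactic.RingSolver as ℤ-Solver
open import Data.Fin using (Fin)
import Data.Fin as Fin
open import Data.List using (List; []; _∷_; length; map; _++_; lookup; tabulate)
open import Data.List.Properties using (length-++; length-map; map-tabulate)
open import Data.List.Relation.Unary.All as All using (All; []; _∷_)
open import Data.List.Relation.Unary.All.Properties using (map⁺; ++⁺)
open import Data.Vec.Functional using () renaming (_∷_ to _∷ᶠ_)
open import Data.Rational as ℚ
  using (ℚ; mkℚ; 0ℚ; 1ℚ; _+_; _*_; _-_; -_; _÷_; 1/_; ceiling; *≤*; *<*; nonNegative; positive)
open import Data.Rational.Literals using (fromℤ)
import Data.Rational.Unnormalised as ℚᵘ
import Data.Rational.Unnormalised.Properties as ℚᵘ
open import Data.Rational.Properties
open import Data.Product using (Σ; _×_; _,_; proj₁; proj₂)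
open import Relation.Nullary using (yes; no; contradiction)
open import Relation.Nullary.Decidable using (dec⇒maybe)
open import Relation.Binary.PropositionalEquality
  using (_≡_; _≗_; refl; sym; trans; cong; cong₂; subst; subst₂; module ≡-Reasoning)
open import Algebra.Properties.CommutativeSemigroup (CommutativeMonoid.commutativeSemigroup +-0-commutativeMonoid)
  using (interchange)
open import Tactic.RingSolver using (solve-∀)
open import Tactic.RingSolver.Core.AlmostCommutativeRing
  using (AlmostCommutativeRing; fromCommutativeRing)
open import Defs

ℚ-ring : AlmostCommutativeRing 0ℓ 0ℓ
ℚ-ring = fromCommutativeRing +-*-commutativeRing (λ x → dec⇒maybe (0ℚ ≟ x))

mutual
  steps≤1+k*depth : ∀ {k T} → IsKTree k T → All (_≤ 1 ℕ.+ k ℕ.* depth T) (steps T)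
  steps≤1+k*depth (leafK _) = s≤s z≤n ∷ []
  steps≤1+k*depth {k} {node v ts} (nodeK _ _ r≤k hts) =
    map⁺ (All.map (λ s≤ → ≤-step (ℕ.+-mono-≤ s≤ r≤k)) (stepsL≤1+k*depthL hts))
    where
    ≤-step : ∀ {s} → s ≤ 1 ℕ.+ k ℕ.* depthL ts ℕ.+ k → s ≤ 1 ℕ.+ k ℕ.* suc (depthL ts)
    ≤-step s≤ = ℕ.≤-trans s≤ (ℕ.≤-reflexive (level k (depthL ts)))
      where
      level : ∀ k d → 1 ℕ.+ k ℕ.* d ℕ.+ k ≡ 1 ℕ.+ k ℕ.* suc d
      level = ℕ-Solver.solve-∀

  stepsL≤1+k*depthL : ∀ {k ts} → IsKTreeL k ts →
                      All (_≤ 1 ℕ.+ k ℕ.* depthL ts) (stepsL ts)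
  stepsL≤1+k*depthL [] = []
  stepsL≤1+k*depthL {k} {t ∷ ts} (ht ∷ hts) =
    ++⁺ (All.map (λ s≤ → ℕ.≤-trans s≤ (raise (ℕ.m≤m⊔n (depth t) (depthL ts))))
                 (steps≤1+k*depth ht))
        (All.map (λ s≤ → ℕ.≤-trans s≤ (raise (ℕ.m≤n⊔m (depth t) (depthL ts))))
                 (stepsL≤1+k*depthL hts))
    where
    raise : ∀ {d e} → d ≤ e → 1 ℕ.+ k ℕ.* d ≤ 1 ℕ.+ k ℕ.* e
    raise d≤e = ℕ.+-monoʳ-≤ 1 (ℕ.*-monoʳ-≤ k d≤e)

1+k*d≤[1+k*c]*[L+1] : ∀ k c L d → d ≤ c ℕ.* (L ℕ.+ 1) →
                      1 ℕ.+ k ℕ.* d ≤ (1 ℕ.+ k ℕ.* c) ℕ.* (L ℕ.+ 1)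
1+k*d≤[1+k*c]*[L+1] k c L d d≤ = begin
  1 ℕ.+ k ℕ.* d                         ≤⟨ ℕ.+-mono-≤ (ℕ.m≤n+m 1 L) (ℕ.*-monoʳ-≤ k d≤) ⟩
  L ℕ.+ 1 ℕ.+ k ℕ.* (c ℕ.* (L ℕ.+ 1))    ≡⟨ expand k c L ⟩
  (1 ℕ.+ k ℕ.* c) ℕ.* (L ℕ.+ 1)          ∎
  where
  open ℕ.≤-Reasoning
  expand : ∀ k c L → L ℕ.+ 1 ℕ.+ k ℕ.* (c ℕ.* (L ℕ.+ 1)) ≡ (1 ℕ.+ k ℕ.* c) ℕ.* (L ℕ.+ 1)
  expand = ℕ-Solver.solve-∀

-- Failing leaves carry the missing money

sumℚ : List ℚ → ℚ
sumℚ [] = 0ℚ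
sumℚ (d ∷ ds) = d + sumℚ ds

failures : List Bool → ℕ
failures [] = 0
failures (true ∷ bs) = failures bs
failures (false ∷ bs) = suc (failures bs)

failedDonations : List Bool → List ℚ → ℚ
failedDonations (true ∷ bs) (d ∷ ds) = failedDonations bs ds
failedDonations (false ∷ bs) (d ∷ ds) = d + failedDonations bs ds
failedDonations _ _ = 0ℚ

sumℚ-++ : ∀ xs ys → sumℚ (xs ++ ys) ≡ sumℚ xs + sumℚ ys
sumℚ-++ [] ys = sym (+-identityˡ _)
sumℚ-++ (x ∷ xs) ys = trans (cong (x +_) (sumℚ-++ xs ys)) (sym (+-assoc x _ _))

failedDonations-++ : ∀ bs bs′ ds ds′ → length bs ≡ length ds →
  failedDonations (bs ++ bs′) (ds ++ ds′) ≡ failedDonations bs ds + failedDonations bs′ ds′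
failedDonations-++ [] bs′ [] ds′ _ = sym (+-identityˡ _)
failedDonations-++ (true ∷ bs) bs′ (d ∷ ds) ds′ eq =
  failedDonations-++ bs bs′ ds ds′ (ℕ.suc-injective eq)
failedDonations-++ (false ∷ bs) bs′ (d ∷ ds) ds′ eq =
  trans (cong (d +_) (failedDonations-++ bs bs′ ds ds′ (ℕ.suc-injective eq)))
        (sym (+-assoc d _ _))

failedDonations-map-∧true : ∀ bs ds →
  failedDonations (map (_∧ true) bs) ds ≡ failedDonations bs ds
failedDonations-map-∧true [] ds = refl
failedDonations-map-∧true (true ∷ bs) [] = refl
failedDonations-map-∧true (false ∷ bs) [] = refl
failedDonations-map-∧true (true ∷ bs) (d ∷ ds) = failedDonations-map-∧true bs ds
failedDonations-map-∧true (false ∷ bs) (d ∷ ds) = cong (d +_) (failedDonations-map-∧true bs ds)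

failedDonations-map-∧false : ∀ bs ds → length bs ≡ length ds →
  failedDonations (map (_∧ false) bs) ds ≡ sumℚ ds
failedDonations-map-∧false [] [] _ = refl
failedDonations-map-∧false (true ∷ bs) (d ∷ ds) eq =
  cong (d +_) (failedDonations-map-∧false bs ds (ℕ.suc-injective eq))
failedDonations-map-∧false (false ∷ bs) (d ∷ ds) eq =
  cong (d +_) (failedDonations-map-∧false bs ds (ℕ.suc-injective eq))

mutual
  length-passes : ∀ T → length (passes T) ≡ length (donations T)
  length-passes (leaf d v) = refl
  length-passes (node v ts) = trans (length-map _ (passesL ts)) (length-passesL ts)

  length-passesL : ∀ ts → length (passesL ts) ≡ length (donationsL ts)
  length-passesL [] = refl
  length-passesL (t ∷ ts) = begin
    length (passes t ++ passesL ts)                   ≡⟨ length-++ (passes t) ⟩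
    length (passes t) ℕ.+ length (passesL ts)         ≡⟨ cong₂ ℕ._+_ (length-passes t) (length-passesL ts) ⟩
    length (donations t) ℕ.+ length (donationsL ts)   ≡⟨ length-++ (donations t) ⟨
    length (donations t ++ donationsL ts)             ∎
    where open ≡-Reasoning

mutual
  sumℚ-donations : ∀ T → sumℚ (donations T) ≡ D T
  sumℚ-donations (leaf d v) = +-identityʳ d
  sumℚ-donations (node v ts) = sumℚ-donationsL ts

  sumℚ-donationsL : ∀ ts → sumℚ (donationsL ts) ≡ Ds ts
  sumℚ-donationsL [] = refl
  sumℚ-donationsL (t ∷ ts) =
    trans (sumℚ-++ (donations t) _) (cong₂ _+_ (sumℚ-donations t) (sumℚ-donationsL ts))

≤-+nonNeg : ∀ {v} d → 0ℚ ℚ.≤ v → d ℚ.≤ v + d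
≤-+nonNeg {v} d 0≤v = ≤-trans (≤-reflexive (sym (+-identityˡ d))) (+-monoˡ-≤ d 0≤v)

mutual
  D≤V+failedDonations : ∀ {k T} → IsKTree k T →
                        D T ℚ.≤ V T + failedDonations (passes T) (donations T)
  D≤V+failedDonations {T = leaf d v} (leafK 0≤v) with v ≟ d
  ... | yes refl = ≤-reflexive (sym (+-identityʳ v))
  ... | no _ = ≤-trans (≤-+nonNeg d 0≤v) (≤-reflexive (cong (v +_) (sym (+-identityʳ d))))
  D≤V+failedDonations {T = node v ts} (nodeK 0≤v _ _ hts) with v ≟ sumV ts
  ... | yes refl = ≤-trans (Ds≤sumV+failedDonations hts)
      (≤-reflexive (cong (sumV ts +_) (sym (failedDonations-map-∧true (passesL ts) (donationsL ts)))))
  ... | no _ = ≤-trans (≤-+nonNeg (Ds ts) 0≤v)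
      (≤-reflexive (cong (v +_) (sym allFail)))
    where
    allFail : failedDonations (map (_∧ false) (passesL ts)) (donationsL ts) ≡ Ds ts
    allFail = trans (failedDonations-map-∧false (passesL ts) (donationsL ts) (length-passesL ts))
                    (sumℚ-donationsL ts)

  Ds≤sumV+failedDonations : ∀ {k ts} → IsKTreeL k ts →
                            Ds ts ℚ.≤ sumV ts + failedDonations (passesL ts) (donationsL ts)
  Ds≤sumV+failedDonations [] = ≤-refl
  Ds≤sumV+failedDonations {ts = t ∷ ts} (ht ∷ hts) = begin
    D t + Ds ts                                       ≤⟨ +-mono-≤ (D≤V+failedDonations ht) (Ds≤sumV+failedDonations hts) ⟩
    (V t + F t) + (sumV ts + Fs)                      ≡⟨ interchange (V t) (F t) (sumV ts) Fs ⟩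
    (V t + sumV ts) + (F t + Fs)                      ≡⟨ cong (V t + sumV ts +_) (failedDonations-++ (passes t) (passesL ts) (donations t) (donationsL ts) (length-passes t)) ⟨
    (V t + sumV ts) + failedDonations (passesL (t ∷ ts)) (donationsL (t ∷ ts)) ∎
    where
    open ≤-Reasoning
    F : Tree → ℚ
    F t = failedDonations (passes t) (donations t)
    Fs : ℚ
    Fs = failedDonations (passesL ts) (donationsL ts)

fromℤ-suc : ∀ n → fromℤ (ℤ.+ suc n) ≡ 1ℚ + fromℤ (ℤ.+ n)
fromℤ-suc n =
  toℚᵘ-injective (ℚᵘ.≃-trans (ℚᵘ.*≡* (cross (ℤ.+ n))) (ℚᵘ.≃-sym (toℚᵘ-homo-+ 1ℚ (fromℤ (ℤ.+ n)))))
  where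
  cross : ∀ x → (ℤ.+ 1 ℤ.+ x) ℤ.* (ℤ.+ 1 ℤ.* ℤ.+ 1) ≡ (ℤ.+ 1 ℤ.* ℤ.+ 1 ℤ.+ x ℤ.* ℤ.+ 1) ℤ.* ℤ.+ 1
  cross = ℤ-Solver.solve-∀

failedDonations≤a*failures : ∀ a bs ds → All (ℚ._≤ a) ds → length bs ≡ length ds →
                             failedDonations bs ds ℚ.≤ a * fromℤ (ℤ.+ failures bs)
failedDonations≤a*failures a [] [] _ _ = ≤-reflexive (sym (*-zeroʳ a))
failedDonations≤a*failures a (true ∷ bs) (d ∷ ds) (_ ∷ ds≤a) eq =
  failedDonations≤a*failures a bs ds ds≤a (ℕ.suc-injective eq)
failedDonations≤a*failures a (false ∷ bs) (d ∷ ds) (d≤a ∷ ds≤a) eq = begin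
  d + failedDonations bs ds              ≤⟨ +-mono-≤ d≤a (failedDonations≤a*failures a bs ds ds≤a (ℕ.suc-injective eq)) ⟩
  a + a * m                              ≡⟨ cong (_+ a * m) (*-identityʳ a) ⟨
  a * 1ℚ + a * m                         ≡⟨ *-distribˡ-+ a 1ℚ m ⟨
  a * (1ℚ + m)                           ≡⟨ cong (a *_) (fromℤ-suc (failures bs)) ⟨
  a * fromℤ (ℤ.+ suc (failures bs))        ∎
  where
  open ≤-Reasoning
  m = fromℤ (ℤ.+ failures bs)

Pr-cong : ∀ n p {E E′} → E ≗ E′ → Pr n p E ≡ Pr n p E′
Pr-cong zero p E≗E′ = cong (λ b → if b then 1ℚ else 0ℚ) (E≗E′ (λ ()))
Pr-cong (suc n) p E≗E′ =
  cong₂ (λ x y → p Fin.zero * x + (1ℚ - p Fin.zero) * y)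
        (Pr-cong n _ (λ s → E≗E′ (true ∷ᶠ s))) (Pr-cong n _ (λ s → E≗E′ (false ∷ᶠ s)))

Pr-true≡1 : ∀ n p → Pr n p (λ _ → true) ≡ 1ℚ
Pr-true≡1 zero p = refl
Pr-true≡1 (suc n) p =
  trans (cong₂ (λ x y → q * x + (1ℚ - q) * y) (Pr-true≡1 n _) (Pr-true≡1 n _)) (split q)
  where
  q = p Fin.zero
  split : ∀ q → q * 1ℚ + (1ℚ - q) * 1ℚ ≡ 1ℚ
  split = solve-∀ ℚ-ring

someParticipantFails : (bs : List Bool) → (Fin (length bs) → Bool) → Bool
someParticipantFails bs s = or (tabulate (λ i → s i ∧ not (lookup bs i)))

errorReported≗someParticipantFails : ∀ T → errorReported T ≗ someParticipantFails (passes T)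
errorReported≗someParticipantFails T s =
  cong or (map-tabulate (λ i → i) (λ i → s i ∧ not (lookup (passes T) i)))

0≤q-p : ∀ {p q} → p ℚ.≤ q → 0ℚ ℚ.≤ q - p
0≤q-p {p} p≤q = ≤-trans (≤-reflexive (sym (+-inverseʳ p))) (+-monoˡ-≤ (- p) p≤q)

^ℚ-nonNeg : ∀ {x} → 0ℚ ℚ.≤ x → ∀ n → 0ℚ ℚ.≤ x ^ℚ n
^ℚ-nonNeg 0≤x zero = *≤* (ℤ.+≤+ z≤n)
^ℚ-nonNeg {x} 0≤x (suc n) =
  ≤-trans (≤-reflexive (sym (*-zeroʳ x))) (*-monoˡ-≤-nonNeg x {{nonNegative 0≤x}} (^ℚ-nonNeg 0≤x n))

^ℚ-antimono : ∀ {x} → 0ℚ ℚ.≤ x → x ℚ.≤ 1ℚ → ∀ {m n} → m ≤ n → x ^ℚ n ℚ.≤ x ^ℚ m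
^ℚ-antimono 0≤x x≤1 {zero} {zero} z≤n = ≤-refl
^ℚ-antimono {x} 0≤x x≤1 {zero} {suc n} z≤n = begin
  x * x ^ℚ n      ≤⟨ *-monoʳ-≤-nonNeg (x ^ℚ n) {{nonNegative (^ℚ-nonNeg 0≤x n)}} x≤1 ⟩
  1ℚ * x ^ℚ n     ≡⟨ *-identityˡ _ ⟩
  x ^ℚ n          ≤⟨ ^ℚ-antimono 0≤x x≤1 {zero} {n} z≤n ⟩
  1ℚ              ∎
  where open ≤-Reasoning
^ℚ-antimono {x} 0≤x x≤1 (s≤s m≤n) = *-monoˡ-≤-nonNeg x {{nonNegative 0≤x}} (^ℚ-antimono 0≤x x≤1 m≤n)

1-[1-δ]^failures≤Pr : ∀ {δ} → 0ℚ ℚ.≤ δ → δ ℚ.≤ 1ℚ →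
  (bs : List Bool) (p : Fin (length bs) → ℚ) → (∀ i → (δ ℚ.≤ p i) × (p i ℚ.≤ 1ℚ)) →
  1ℚ - (1ℚ - δ) ^ℚ failures bs ℚ.≤ Pr (length bs) p (someParticipantFails bs)
1-[1-δ]^failures≤Pr 0≤δ δ≤1 [] p p∈[δ,1] = ≤-refl
1-[1-δ]^failures≤Pr 0≤δ δ≤1 (true ∷ bs) p p∈[δ,1] =
  ≤-trans (1-[1-δ]^failures≤Pr 0≤δ δ≤1 bs _ (λ i → p∈[δ,1] (Fin.suc i)))
          (≤-reflexive (sym (average (p Fin.zero) _)))
  where
  average : ∀ q P → q * P + (1ℚ - q) * P ≡ P
  average = solve-∀ ℚ-ring
1-[1-δ]^failures≤Pr {δ} 0≤δ δ≤1 (false ∷ bs) p p∈[δ,1] = begin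
  1ℚ - (1ℚ - δ) * r                  ≤⟨ +-monoʳ-≤ 1ℚ (neg-antimono-≤ [1-q]r≤[1-δ]r) ⟩
  1ℚ - (1ℚ - q) * r                  ≡⟨ split q r ⟨
  q * 1ℚ + (1ℚ - q) * (1ℚ - r)       ≤⟨ +-monoʳ-≤ (q * 1ℚ) (*-monoˡ-≤-nonNeg (1ℚ - q) {{nonNegative (0≤q-p q≤1)}} IH) ⟩
  q * 1ℚ + (1ℚ - q) * P              ≡⟨ cong (λ x → q * x + (1ℚ - q) * P) (Pr-true≡1 (length bs) _) ⟨
  q * Pr (length bs) _ (λ _ → true) + (1ℚ - q) * P ∎
  where
  open ≤-Reasoning
  q = p Fin.zero
  q≤1 = proj₂ (p∈[δ,1] Fin.zero)
  r = (1ℚ - δ) ^ℚ failures bs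
  P = Pr (length bs) (λ i → p (Fin.suc i)) (someParticipantFails bs)
  IH = 1-[1-δ]^failures≤Pr 0≤δ δ≤1 bs _ (λ i → p∈[δ,1] (Fin.suc i))
  [1-q]r≤[1-δ]r : (1ℚ - q) * r ℚ.≤ (1ℚ - δ) * r
  [1-q]r≤[1-δ]r = *-monoʳ-≤-nonNeg r {{nonNegative (^ℚ-nonNeg (0≤q-p δ≤1) (failures bs))}}
                    (+-monoʳ-≤ 1ℚ (neg-antimono-≤ (proj₁ (p∈[δ,1] Fin.zero))))
  split : ∀ q r → q * 1ℚ + (1ℚ - q) * (1ℚ - r) ≡ 1ℚ - (1ℚ - q) * r
  split = solve-∀ ℚ-ring

ε*d<f : ∀ ε d v f → v ℚ.< (1ℚ - ε) * d → d ℚ.≤ v + f → ε * d ℚ.< f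
ε*d<f ε d v f v< d≤ = begin-strict
  ε * d                ≡⟨ rearrange ε d ⟩
  d - (1ℚ - ε) * d     <⟨ +-monoʳ-< d (neg-antimono-< v<) ⟩
  d - v                ≤⟨ +-monoˡ-≤ (- v) d≤ ⟩
  v + f - v            ≡⟨ cancel v f ⟩
  f                    ∎
  where
  open ≤-Reasoning
  rearrange : ∀ ε d → ε * d ≡ d - (1ℚ - ε) * d
  rearrange = solve-∀ ℚ-ring
  cancel : ∀ v f → v + f - v ≡ f
  cancel = solve-∀ ℚ-ring

0≤ε*d : ∀ ε d v → 0ℚ ℚ.≤ v → 0ℚ ℚ.≤ ε → ε ℚ.≤ 1ℚ → v ℚ.< (1ℚ - ε) * d → 0ℚ ℚ.≤ ε * d
0≤ε*d ε d v 0≤v 0≤ε ε≤1 v< = nonNegative⁻¹ (ε * d)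
  {{nonNeg*nonNeg⇒nonNeg ε {{nonNegative 0≤ε}} d {{nonNegative (<⇒≤ 0<d)}}}}
  where
  0<d : 0ℚ ℚ.< d
  0<d = *-cancelˡ-<-nonNeg (1ℚ - ε) {{nonNegative (0≤q-p ε≤1)}}
          (subst (ℚ._< (1ℚ - ε) * d) (sym (*-zeroʳ (1ℚ - ε))) (≤-<-trans 0≤v v<))

÷-bounds : ∀ x a t .{{_ : ℚ.NonZero a}} → 0ℚ ℚ.≤ x → x ℚ.< a * t → 0ℚ ℚ.≤ t →
           (0ℚ ℚ.≤ x ÷ a) × (x ÷ a ℚ.< t)
÷-bounds x a t 0≤x x<at 0≤t =
  *-cancelʳ-≤-pos a {{positive 0<a}} (subst₂ ℚ._≤_ (sym (*-zeroˡ a)) (sym [x÷a]*a≡x) 0≤x) ,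
  *-cancelʳ-<-nonNeg a {{nonNegative (<⇒≤ 0<a)}} (subst₂ ℚ._<_ (sym [x÷a]*a≡x) (*-comm a t) x<at)
  where
  0<a : 0ℚ ℚ.< a
  0<a with 0ℚ <? a
  ... | yes 0<a = 0<a
  ... | no 0≮a = contradiction (<-≤-trans (≤-<-trans 0≤x x<at) at≤0) (<-irrefl refl)
    where
    at≤0 : a * t ℚ.≤ 0ℚ
    at≤0 = ≤-trans (*-monoʳ-≤-nonNeg t {{nonNegative 0≤t}} (≮⇒≥ 0≮a)) (≤-reflexive (*-zeroˡ t))
  [x÷a]*a≡x : (x ÷ a) * a ≡ x
  [x÷a]*a≡x = trans (*-assoc x (1/ a) a) (trans (cong (x *_) (*-inverseˡ a)) (*-identityʳ x))

-- ∣ -[1+ m ] /ℕ d ∣ is ⌈(1 + m)/d⌉, which exceeds ⌊(1 + m)/d⌋ by at most one.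
∣-[1+m]/ℕd∣≤n : ∀ m d n .{{_ : NonZero d}} → suc m ℕ./ d < n → ∣ -[1+ m ] /ℕ d ∣ ≤ n
∣-[1+m]/ℕd∣≤n m d n q<n with suc m % d
... | zero = subst (_≤ n) (sym (ℤ.∣-i∣≡∣i∣ (ℤ.+ (suc m ℕ./ d)))) (ℕ.<⇒≤ q<n)
... | suc _ = q<n

∣ceiling∣≤ : ∀ y n → 0ℚ ℚ.≤ y → y ℚ.< fromℤ (ℤ.+ n) → ∣ ceiling y ∣ ≤ n
∣ceiling∣≤ (mkℚ (ℤ.+ zero) _ _) n _ _ = z≤n
∣ceiling∣≤ y@(mkℚ +[1+ m ] d _) n _ (*<* num<) =
  subst (_≤ n) (sym ∣ceiling∣≡) (∣-[1+m]/ℕd∣≤n m (suc d) n quotient<)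
  where
  [1+m]<n*[1+d] : suc m < n ℕ.* suc d
  [1+m]<n*[1+d] = subst₂ _<_ (ℕ.*-identityʳ (suc m)) refl
    (ℤ.drop‿+<+ (subst₂ ℤ._<_ (sym (ℤ.pos-* (suc m) 1)) (sym (ℤ.pos-* n (suc d))) num<))
  quotient< : suc m ℕ./ suc d < n
  quotient< = ℕ.*-cancelʳ-< (suc d) _ n (ℕ.≤-<-trans (m/n*n≤m (suc m) (suc d)) [1+m]<n*[1+d])
  ∣ceiling∣≡ : ∣ ceiling y ∣ ≡ ∣ -[1+ m ] /ℕ suc d ∣
  ∣ceiling∣≡ = trans (ℤ.∣-i∣≡∣i∣ (-[1+ m ] ℤ./ ℤ.+ suc d)) (cong ∣_∣ (div-pos-is-/ℕ -[1+ m ] (suc d)))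
∣ceiling∣≤ (mkℚ -[1+ _ ] _ _) n (*≤* ()) _

0≤V : ∀ {k T} → IsKTree k T → 0ℚ ℚ.≤ V T
0≤V (leafK 0≤v) = 0≤v
0≤V (nodeK 0≤v _ _ _) = 0≤v

underReport⇒errorLikely :
  ∀ {k} (T : Tree) → IsKTree k T →
  (a : ℚ) → .{{_ : ℚ.NonZero a}} → All (λ d → (1ℚ ℚ.≤ d) × (d ℚ.≤ a)) (donations T) →
  (δ : ℚ) → 0ℚ ℚ.≤ δ → δ ℚ.≤ 1ℚ →
  (p : Fin (length (passes T)) → ℚ) → (∀ i → (δ ℚ.≤ p i) × (p i ℚ.≤ 1ℚ)) →
  (ε : ℚ) → 0ℚ ℚ.< ε → ε ℚ.< 1ℚ → V T ℚ.< (1ℚ - ε) * D T →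
  1ℚ - (1ℚ - δ) ^ℚ ∣ ceiling ((ε * D T) ÷ a) ∣ ℚ.≤ Pr (length (passes T)) p (errorReported T)
underReport⇒errorLikely T isK a d∈[1,a] δ 0≤δ δ≤1 p p∈[δ,1] ε 0<ε ε<1 V< = begin
  1ℚ - (1ℚ - δ) ^ℚ ∣ ceiling ((ε * D T) ÷ a) ∣
    ≤⟨ +-monoʳ-≤ 1ℚ (neg-antimono-≤ (^ℚ-antimono (0≤q-p δ≤1) 1-δ≤1 ⌈εD/a⌉≤failures)) ⟩
  1ℚ - (1ℚ - δ) ^ℚ failures (passes T)
    ≤⟨ 1-[1-δ]^failures≤Pr 0≤δ δ≤1 (passes T) p p∈[δ,1] ⟩
  Pr (length (passes T)) p (someParticipantFails (passes T))
    ≡⟨ Pr-cong (length (passes T)) p (errorReported≗someParticipantFails T) ⟨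
  Pr (length (passes T)) p (errorReported T) ∎
  where
  open ≤-Reasoning
  m : ℚ
  m = fromℤ (ℤ.+ failures (passes T))
  εD<a*m : ε * D T ℚ.< a * m
  εD<a*m = <-≤-trans (ε*d<f ε (D T) (V T) _ V< (D≤V+failedDonations isK))
    (failedDonations≤a*failures a (passes T) (donations T) (All.map proj₂ d∈[1,a]) (length-passes T))
  εD/a-bounds : (0ℚ ℚ.≤ (ε * D T) ÷ a) × ((ε * D T) ÷ a ℚ.< m)
  εD/a-bounds = ÷-bounds (ε * D T) a m (0≤ε*d ε (D T) (V T) (0≤V isK) (<⇒≤ 0<ε) (<⇒≤ ε<1) V<)
                        εD<a*m (nonNegative⁻¹ m)
  ⌈εD/a⌉≤failures : ∣ ceiling ((ε * D T) ÷ a) ∣ ≤ failures (passes T)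
  ⌈εD/a⌉≤failures = ∣ceiling∣≤ _ _ (proj₁ εD/a-bounds) (proj₂ εD/a-bounds)
  1-δ≤1 : 1ℚ - δ ℚ.≤ 1ℚ
  1-δ≤1 = +-monoʳ-≤ 1ℚ (neg-antimono-≤ 0≤δ)

mainTheorem4 : (k : ℕ) → .{{_ : NonZero k}} → 2 ≤ k →
    (c : ℕ) → Σ ℕ λ C →
    (T : Tree) → IsKTree k T →
    depth T ≤ c ℕ.* (logK k (nLeaves T) ℕ.+ 1) →
    All (λ s → s ≤ C ℕ.* (logK k (nLeaves T) ℕ.+ 1)) (steps T)
    ×
    ((a : ℚ) → .{{_ : ℚ.NonZero a}} →
     All (λ d → (1ℚ ℚ.≤ d) × (d ℚ.≤ a)) (donations T) →
     (δ : ℚ) → 0ℚ ℚ.≤ δ → δ ℚ.≤ 1ℚ →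
     (p : Fin (length (passes T)) → ℚ) →
     ((i : Fin (length (passes T))) → (δ ℚ.≤ p i) × (p i ℚ.≤ 1ℚ)) →
     (ε : ℚ) → 0ℚ ℚ.< ε → ε ℚ.< 1ℚ →
     V T ℚ.< (1ℚ - ε) ℚ.* D T →
     1ℚ - ((1ℚ - δ) ^ℚ ∣ ceiling ((ε ℚ.* D T) ÷ a) ∣)
       ℚ.≤ Pr (length (passes T)) p (errorReported T))
mainTheorem4 k _ c = 1 ℕ.+ k ℕ.* c , λ T isK depth≤ →
  All.map (λ s≤ → ℕ.≤-trans s≤ (1+k*d≤[1+k*c]*[L+1] k c _ _ depth≤)) (steps≤1+k*depth isK) ,
  underReport⇒errorLikely T isK
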